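{- Let $A=(a_{i,j})_{1\le i,j\le n}$ be a symmetric $n\times n$ matrix with non-negative integer entries. Define $\Phi(A)$ as follows: form the two-line array containing, for every $1\le i,j\le n$, exactly $a_{i,j}$ columns $\binom{i}{j}$ (top entry $i$, bottom entry $j$), ordered lexicographically (by top entry, then bottom entry), and apply RSK row insertion to the entries of its bottom row, from left to right, starting with the empty tableau; $\Phi(A)$ is the resulting insertion tableau. Define $\Psi(A)$ as follows: form the two-line array containing, for every $1\le i\le j\le n$, exactly $a_{i,j}$ columns $\binom{j}{i}$ (top entry $j$, bottom entry $i$), ordered lexicographically; processing its columns from left to right, starting with the empty tableau, for the current column $\binom{j}{i}$ insert $i$ into the current tableau by RSK row insertion, and if $i<j$ and this insertion ends by adding a new cell in row $r$, then additionally place $j$ in row $r+1$ in the leftmost column having no entry in that row; $\Psi(A)$ is the final tableau. Then $\Psi(A)=\Phi(A)$.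
   Context: RSK row insertion of $x$ into a semistandard Young tableau: $x$ is placed at the end of row 1 if it is at least all entries of that row; otherwise it replaces the leftmost entry of row 1 strictly greater than $x$, and the replaced entry is inserted into row 2 by the same rule, and so on; the insertion ends when an entry is added at the end of some row (possibly a new row). -}

module Defs where

open import Data.Nat using (ℕ; zero; suc; _<ᵇ_; _≤ᵇ_)
open import Data.Fin using (Fin; toℕ)
open import Data.Bool using (Bool; true; false; if_then_else_)
open import Data.List using (List; []; _∷_; _++_; [_]; concatMap; replicate; allFin; foldl)
open import Data.Maybe using (Maybe; just; nothing)
open import Data.Product using (_×_; _,_; proj₁)
open import Relation.Binary.PropositionalEquality using (_≡_)

-- A tableau is a list of rows (row 1 first), each row a list of entries left to right.
Tableau : Set
Tableau = List (List ℕ)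

rowInsert : ℕ → List ℕ → Maybe ℕ × List ℕ
rowInsert x [] = nothing , x ∷ []
rowInsert x (y ∷ ys) with x <ᵇ y
... | true  = just y , x ∷ ys
... | false with rowInsert x ys
...   | b , ys' = b , y ∷ ys'

-- RSK row insertion; also returns the (0-based) index of the row in which the
-- insertion ends by adding a cell at its end (possibly a new row).
rsk : ℕ → Tableau → Tableau × ℕ
rsk x [] = ((x ∷ []) ∷ []) , 0
rsk x (row ∷ rows) with rowInsert x row
... | nothing , row' = (row' ∷ rows) , 0
... | just y , row' with rsk y rows
...   | t , r = (row' ∷ t) , suc r

-- Place j at the end of row k (0-based), i.e. in the leftmost column having no
-- entry in that row; if row k does not exist, create it (only k = length is used).
placeAt : ℕ → ℕ → Tableau → Tableau
placeAt zero    j []           = (j ∷ []) ∷ []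
placeAt zero    j (row ∷ rows) = (row ++ (j ∷ [])) ∷ rows
placeAt (suc k) j []           = [] ∷ placeAt k j []
placeAt (suc k) j (row ∷ rows) = row ∷ placeAt k j rows

-- Matrices n×n with entries in ℕ, indices Fin n (index i stands for i+1).
Matrix : ℕ → Set
Matrix n = Fin n → Fin n → ℕ

Symmetric : ∀ {n} → Matrix n → Set
Symmetric {n} A = ∀ (i j : Fin n) → A i j ≡ A j i

-- Bottom row of the lexicographically ordered two-line array with a_{i,j} columns (i over j).
phiWord : ∀ {n} → Matrix n → List ℕ
phiWord {n} A = concatMap (λ i → concatMap (λ j → replicate (A i j) (suc (toℕ j))) (allFin n)) (allFin n)

Φ : ∀ {n} → Matrix n → Tableau
Φ A = foldl (λ T x → proj₁ (rsk x T)) [] (phiWord A)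

psiArray : ∀ {n} → Matrix n → List (ℕ × ℕ)
psiArray {n} A = concatMap (λ j → concatMap (λ i →
    if toℕ i ≤ᵇ toℕ j then replicate (A i j) (suc (toℕ j) , suc (toℕ i)) else [])
  (allFin n)) (allFin n)

psiStep : Tableau → ℕ × ℕ → Tableau
psiStep T (j , i) with rsk i T
... | T' , r = if i <ᵇ j then placeAt (suc r) j T' else T'

Ψ : ∀ {n} → Matrix n → Tableau
Ψ A = foldl psiStep [] (psiArray A)

{-# OPTIONS --safe #-}

-- Let P(i,k) be the insertion tableau of the part of the Φ-word coming from the rows < i and the
-- columns < k of A.  Inserting a letter x < c commutes with appending letters c to the rows: only
-- the first c of the row where x ends can be bumped, one row down.  Hence P(i,k+1) is P(i,k) with
-- some letters k+1 appended, and the shapes λ(i,k) obey Fomin's local rule for RSK growth diagrams.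
-- The rule is symmetric in λ(i,k+1) and λ(i+1,k), so λ(i,k) = λ(k,i) when A is symmetric.
-- By symmetry, column k+1 of the Ψ-array inserts into P(k,k) the letters ≤ k of row k+1 of the
-- Φ-array, producing P(k+1,k), and places a letter k+1 below each insertion before appending the
-- diagonal letters k+1.  Since the insertions of a weakly increasing word end in weakly decreasing
-- rows, none of these letters k+1 is ever bumped, and the local rule on the diagonal, where
-- λ(k,k+1) = λ(k+1,k), says that P(k+1,k+1) has exactly as many letters k+1 in each row.
-- So Ψ(A) = P(n,n) = Φ(A).

module Submission where

open import Defs
open import Data.Bool using (true; false; T; if_then_else_)
open import Data.Bool.Properties using (T-≡)
open import Data.Empty using (⊥-elim)
open import Data.Fin as Fin using (Fin; toℕ; fromℕ<)
open import Data.Fin.Properties using (toℕ<n; fromℕ<-toℕ)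
open import Data.List
  using (List; []; _∷_; _++_; [_]; replicate; length; foldl; map; concat; concatMap; allFin; upTo; applyUpTo; tabulate)
open import Data.List.Properties
  using (++-identityʳ; ++-assoc; ++-conicalˡ; ++-conicalʳ; length-++; length-replicate; foldl-++; map-++;
         map-replicate; map-tabulate; map-upTo; upTo-∷ʳ; concatMap-++)
open import Data.List.Membership.Propositional using (_∈_)
open import Data.List.Relation.Unary.All as All using (All; []; _∷_)
open import Data.List.Relation.Unary.All.Properties using (++⁺; replicate⁺)
open import Data.List.Relation.Unary.Any using (here; there)
open import Data.List.Relation.Unary.AllPairs using (AllPairs; []; _∷_)
import Data.List.Relation.Unary.AllPairs.Properties as AllPairs
open import Data.Maybe using (just; nothing)
open import Data.Nat
open import Data.Nat.Properties
open import Data.Product using (_×_; _,_; proj₁; proj₂)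
open import Data.Sum using (inj₁; inj₂)
open import Function using (Equivalence; _∘_; flip; id)
open import Relation.Binary.PropositionalEquality hiding ([_])
open import Relation.Nullary using (yes; no)

<⇒<ᵇ≡true : ∀ {x y} → x < y → (x <ᵇ y) ≡ true
<⇒<ᵇ≡true p = Equivalence.to T-≡ (<⇒<ᵇ p)

<ᵇ≡true⇒< : ∀ {x y} → (x <ᵇ y) ≡ true → x < y
<ᵇ≡true⇒< {x} {y} eq = <ᵇ⇒< x y (Equivalence.from T-≡ eq)

<ᵇ≡false⇒≥ : ∀ {x y} → (x <ᵇ y) ≡ false → y ≤ x
<ᵇ≡false⇒≥ eq = ≮⇒≥ (λ p → subst T eq (<⇒<ᵇ p))

≥⇒<ᵇ≡false : ∀ {x y} → y ≤ x → (x <ᵇ y) ≡ false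
≥⇒<ᵇ≡false {x} {y} p with x <ᵇ y in eq
... | false = refl
... | true  = ⊥-elim (≤⇒≯ p (<ᵇ≡true⇒< eq))

≤⇒≤ᵇ≡true : ∀ {i j} → i ≤ j → (i ≤ᵇ j) ≡ true
≤⇒≤ᵇ≡true p = Equivalence.to T-≡ (≤⇒≤ᵇ p)

>⇒≤ᵇ≡false : ∀ {i j} → j < i → (i ≤ᵇ j) ≡ false
>⇒≤ᵇ≡false {i} {j} j<i with i ≤ᵇ j in eq
... | false = refl
... | true  = ⊥-elim (<⇒≱ j<i (≤ᵇ⇒≤ i j (Equivalence.from T-≡ eq)))

Sorted : List ℕ → Set
Sorted = AllPairs _≤_

rowInsert-nothing : ∀ x R {R'} → rowInsert x R ≡ (nothing , R') → R' ≡ R ++ [ x ] × All (_≤ x) R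
rowInsert-nothing x [] refl = refl , []
rowInsert-nothing x (y ∷ R) eq with x <ᵇ y in x<y
... | false with rowInsert x R in eq′
rowInsert-nothing x (y ∷ R) refl | false | nothing , R' with rowInsert-nothing x R eq′
... | refl , R≤x = refl , <ᵇ≡false⇒≥ x<y ∷ R≤x

rowInsert-just : ∀ x R {y R'} → rowInsert x R ≡ (just y , R') → x < y × y ∈ R
rowInsert-just x (z ∷ R) eq with x <ᵇ z in x<z
rowInsert-just x (z ∷ R) refl | true = <ᵇ≡true⇒< x<z , here refl
... | false with rowInsert x R in eq′
rowInsert-just x (z ∷ R) refl | false | just y , R' with rowInsert-just x R eq′
... | x<y , y∈R = x<y , there y∈R

rowInsert-just-length : ∀ x R {y R'} → rowInsert x R ≡ (just y , R') → length R' ≡ length R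
rowInsert-just-length x (z ∷ R) eq with x <ᵇ z
rowInsert-just-length x (z ∷ R) refl | true = refl
... | false with rowInsert x R in eq′
rowInsert-just-length x (z ∷ R) refl | false | just y , R' = cong suc (rowInsert-just-length x R eq′)

rowInsert-++-just : ∀ x R S {y R'} → rowInsert x R ≡ (just y , R') → rowInsert x (R ++ S) ≡ (just y , R' ++ S)
rowInsert-++-just x (z ∷ R) S eq with x <ᵇ z
rowInsert-++-just x (z ∷ R) S refl | true = refl
... | false with rowInsert x R in eq′
rowInsert-++-just x (z ∷ R) S refl | false | just y , R' rewrite rowInsert-++-just x R S eq′ = refl

rowInsert-++-nothing : ∀ x R S {R'} → rowInsert x R ≡ (nothing , R') →
  rowInsert x (R ++ S) ≡ (proj₁ (rowInsert x S) , R ++ proj₂ (rowInsert x S))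
rowInsert-++-nothing x [] S eq = refl
rowInsert-++-nothing x (z ∷ R) S eq with x <ᵇ z
rowInsert-++-nothing x (z ∷ R) S () | true
... | false with rowInsert x R in eq′
rowInsert-++-nothing x (z ∷ R) S refl | false | nothing , R' rewrite rowInsert-++-nothing x R S eq′ = refl

rowInsert-append : ∀ x R → All (_≤ x) R → rowInsert x R ≡ (nothing , R ++ [ x ])
rowInsert-append x [] [] = refl
rowInsert-append x (z ∷ R) (z≤x ∷ R≤x) rewrite ≥⇒<ᵇ≡false z≤x | rowInsert-append x R R≤x = refl

rowInsert-++-replicate : ∀ x R c a {R'} → rowInsert x R ≡ (nothing , R') → x < c →
  rowInsert x (R ++ replicate (suc a) c) ≡ (just c , R ++ x ∷ replicate a c)
rowInsert-++-replicate x R c a eq x<c rewrite rowInsert-++-nothing x R (replicate (suc a) c) eq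
                                            | <⇒<ᵇ≡true x<c = refl

rowInsert-All : ∀ {P : ℕ → Set} x R → P x → All P R → All P (proj₂ (rowInsert x R))
rowInsert-All x [] px [] = px ∷ []
rowInsert-All x (z ∷ R) px (pz ∷ pR) with x <ᵇ z
... | true = px ∷ pR
... | false with rowInsert x R | rowInsert-All x R px pR
... | _ , R' | pR' = pz ∷ pR'

rowInsert-sorted : ∀ x R → Sorted R → Sorted (proj₂ (rowInsert x R))
rowInsert-sorted x [] [] = [] ∷ []
rowInsert-sorted x (z ∷ R) (z≤R ∷ sR) with x <ᵇ z in x<z
... | true = All.map (≤-trans (<⇒≤ (<ᵇ≡true⇒< x<z))) z≤R ∷ sR
... | false with rowInsert x R | rowInsert-sorted x R sR | rowInsert-All {z ≤_} x R (<ᵇ≡false⇒≥ x<z) z≤R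
... | _ , R' | sR' | z≤R' = z≤R' ∷ sR'

rowInsert-nonempty : ∀ x R → proj₂ (rowInsert x R) ≢ []
rowInsert-nonempty x [] ()
rowInsert-nonempty x (z ∷ R) with x <ᵇ z
... | true = λ ()
... | false with rowInsert x R
... | _ = λ ()

rowInsert-bumped-mono : ∀ x x' R {y y' R' R''} → Sorted R → x ≤ x' →
  rowInsert x R ≡ (just y , R') → rowInsert x' R' ≡ (just y' , R'') → y ≤ y'
rowInsert-bumped-mono x x' (z ∷ R) (z≤R ∷ sR) x≤x' eq eq' with x <ᵇ z in x<z
rowInsert-bumped-mono x x' (z ∷ R) (z≤R ∷ sR) x≤x' refl eq' | true
  rewrite ≥⇒<ᵇ≡false {x'} {x} x≤x' with rowInsert x' R in eq″
rowInsert-bumped-mono x x' (z ∷ R) (z≤R ∷ sR) x≤x' refl refl | true | just y' , _ =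
  All.lookup z≤R (proj₂ (rowInsert-just x' R eq″))
rowInsert-bumped-mono x x' (z ∷ R) (z≤R ∷ sR) x≤x' eq eq' | false with rowInsert x R in eq″
rowInsert-bumped-mono x x' (z ∷ R) (z≤R ∷ sR) x≤x' refl eq' | false | just y , R'
  rewrite ≥⇒<ᵇ≡false {x'} {z} (≤-trans (<ᵇ≡false⇒≥ x<z) x≤x') with rowInsert x' R' in eq‴
rowInsert-bumped-mono x x' (z ∷ R) (z≤R ∷ sR) x≤x' refl refl | false | just y , R' | just y' , _ =
  rowInsert-bumped-mono x x' R sR x≤x' eq″ eq‴

insert : ℕ → Tableau → Tableau
insert x T = proj₁ (rsk x T)

endRow : ℕ → Tableau → ℕ
endRow x T = proj₂ (rsk x T)

row : Tableau → ℕ → List ℕ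
row []      s       = []
row (R ∷ T) zero    = R
row (R ∷ T) (suc s) = row T s

rowLength : Tableau → ℕ → ℕ
rowLength T s = length (row T s)

δ : ℕ → ℕ → ℕ
δ zero    zero    = 1
δ zero    (suc s) = 0
δ (suc r) zero    = 0
δ (suc r) (suc s) = δ r s

δ-refl : ∀ r → δ r r ≡ 1
δ-refl zero    = refl
δ-refl (suc r) = δ-refl r

δ-≢ : ∀ r s → r ≢ s → δ r s ≡ 0
δ-≢ zero    zero    r≢s = ⊥-elim (r≢s refl)
δ-≢ zero    (suc s) _   = refl
δ-≢ (suc r) zero    _   = refl
δ-≢ (suc r) (suc s) r≢s = δ-≢ r s (r≢s ∘ cong suc)

AllEntries : (ℕ → Set) → Tableau → Set
AllEntries P = All (All P)

RowsSorted : Tableau → Set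
RowsSorted = All Sorted

NoEmptyRows : Tableau → Set
NoEmptyRows = All (_≢ [])

insert-AllEntries : ∀ {P : ℕ → Set} x T → P x → AllEntries P T → AllEntries P (insert x T)
insert-AllEntries x [] px [] = (px ∷ []) ∷ []
insert-AllEntries x (R ∷ T) px (pR ∷ pT) with rowInsert x R in eq
... | nothing , R' = subst (All _) (cong proj₂ eq) (rowInsert-All x R px pR) ∷ pT
... | just y , R' = subst (All _) (cong proj₂ eq) (rowInsert-All x R px pR)
                    ∷ insert-AllEntries y T (All.lookup pR (proj₂ (rowInsert-just x R eq))) pT

insert-RowsSorted : ∀ x T → RowsSorted T → RowsSorted (insert x T)
insert-RowsSorted x [] [] = ([] ∷ []) ∷ []
insert-RowsSorted x (R ∷ T) (sR ∷ sT) with rowInsert x R in eq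
... | nothing , R' = subst Sorted (cong proj₂ eq) (rowInsert-sorted x R sR) ∷ sT
... | just y , R' = subst Sorted (cong proj₂ eq) (rowInsert-sorted x R sR) ∷ insert-RowsSorted y T sT

insert-NoEmptyRows : ∀ x T → NoEmptyRows T → NoEmptyRows (insert x T)
insert-NoEmptyRows x [] [] = (λ ()) ∷ []
insert-NoEmptyRows x (R ∷ T) (_ ∷ neT) with rowInsert x R in eq
... | nothing , R' = (λ R'≡[] → rowInsert-nonempty x R (trans (cong proj₂ eq) R'≡[])) ∷ neT
... | just y , R' = (λ R'≡[] → rowInsert-nonempty x R (trans (cong proj₂ eq) R'≡[]))
                    ∷ insert-NoEmptyRows y T neT

endRow<length : ∀ x T → endRow x T < length (insert x T)
endRow<length x [] = s≤s z≤n
endRow<length x (R ∷ T) with rowInsert x R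
... | nothing , R' = s≤s z≤n
... | just y , R' = s≤s (endRow<length y T)

insert-rowLength : ∀ x T s → rowLength (insert x T) s ≡ rowLength T s + δ (endRow x T) s
insert-rowLength x [] zero = refl
insert-rowLength x [] (suc s) = refl
insert-rowLength x (R ∷ T) s with rowInsert x R in eq
insert-rowLength x (R ∷ T) zero | nothing , R'
  rewrite proj₁ (rowInsert-nothing x R eq) = length-++ R
insert-rowLength x (R ∷ T) (suc s) | nothing , R' = sym (+-identityʳ _)
insert-rowLength x (R ∷ T) zero | just y , R' =
  trans (rowInsert-just-length x R eq) (sym (+-identityʳ _))
insert-rowLength x (R ∷ T) (suc s) | just y , R' = insert-rowLength y T s

rowBumping : ∀ x y T → RowsSorted T → x ≤ y → endRow y (insert x T) ≤ endRow x T
rowBumping x y [] [] x≤y rewrite ≥⇒<ᵇ≡false {y} {x} x≤y = z≤n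
rowBumping x y (R ∷ T) (sR ∷ sT) x≤y with rowInsert x R in eq
... | nothing , R' with rowInsert-nothing x R eq
...   | refl , R≤x
  rewrite rowInsert-append y (R ++ [ x ]) (++⁺ (All.map (flip ≤-trans x≤y) R≤x) (x≤y ∷ [])) = z≤n
rowBumping x y (R ∷ T) (sR ∷ sT) x≤y | just b , R' with rowInsert y R' in eq′
... | nothing , _ = z≤n
... | just b' , _ = s≤s (rowBumping b b' T sT (rowInsert-bumped-mono x y R sR x≤y eq eq′))

-- Appending copies of a largest letter

replicate-+ : ∀ {A : Set} m n (c : A) → replicate (m + n) c ≡ replicate m c ++ replicate n c
replicate-+ zero    n c = refl
replicate-+ (suc m) n c = cong (c ∷_) (replicate-+ m n c)

row-All : ∀ {P : ℕ → Set} T s → AllEntries P T → All P (row T s)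
row-All [] s [] = []
row-All (R ∷ T) zero (pR ∷ _) = pR
row-All (R ∷ T) (suc s) (_ ∷ pT) = row-All T s pT

record Extends (c : ℕ) (P : Tableau) (m : ℕ → ℕ) (T : Tableau) : Set where
  field rows : ∀ s → row T s ≡ row P s ++ replicate (m s) c
open Extends

Extends-refl : ∀ c P → Extends c P (λ _ → 0) P
Extends-refl c P .rows s = sym (++-identityʳ (row P s))

Extends-trans : ∀ {c P T U m n} → Extends c P m T → Extends c T n U → Extends c P (λ s → m s + n s) U
Extends-trans {c} {P} {T} {U} {m} {n} PT TU .rows s = begin
  row U s                                             ≡⟨ TU .rows s ⟩
  row T s ++ replicate (n s) c                        ≡⟨ cong (_++ replicate (n s) c) (PT .rows s) ⟩
  (row P s ++ replicate (m s) c) ++ replicate (n s) c ≡⟨ ++-assoc (row P s) _ _ ⟩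
  row P s ++ (replicate (m s) c ++ replicate (n s) c) ≡⟨ cong (row P s ++_) (replicate-+ (m s) (n s) c) ⟨
  row P s ++ replicate (m s + n s) c                  ∎
  where open ≡-Reasoning

Extends-cong : ∀ {c P T m n} → (∀ s → m s ≡ n s) → Extends c P m T → Extends c P n T
Extends-cong {c} {P} m≗n PT .rows s = trans (PT .rows s) (cong (λ k → row P s ++ replicate k c) (m≗n s))

Extends-[] : ∀ {c P m} → Extends c P m [] → ∀ s → row P s ≡ [] × m s ≡ 0
Extends-[] {c} {P} {m} P[] s =
  ++-conicalˡ (row P s) _ (sym (P[] .rows s)) , replicate≡[]⇒0 (++-conicalʳ (row P s) _ (sym (P[] .rows s)))
  where
  replicate≡[]⇒0 : ∀ {k} → replicate k c ≡ [] → k ≡ 0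
  replicate≡[]⇒0 {zero} _ = refl

Extends-row₀ : ∀ {c P m T} → Extends c P m T → AllEntries (_≤ c) P → All (_≤ c) (row T 0)
Extends-row₀ {c} {P} {m} PT P≤c rewrite PT .rows 0 = ++⁺ (row-All P 0 P≤c) (replicate⁺ (m 0) ≤-refl)

Extends-rowLength : ∀ {c U m T} → Extends c U m T → ∀ s → rowLength T s ≡ rowLength U s + m s
Extends-rowLength {c} {U} {m} UT s rewrite UT .rows s | length-++ (row U s) {replicate (m s) c} =
  cong (rowLength U s +_) (length-replicate (m s))

insert-max : ∀ c T → All (_≤ c) (row T 0) → endRow c T ≡ 0 × Extends c T (δ 0) (insert c T)
insert-max c [] [] = refl , record { rows = λ { zero → refl ; (suc s) → refl } }
insert-max c (R ∷ T) R≤c rewrite rowInsert-append c R R≤c =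
  refl , record { rows = λ { zero → refl ; (suc s) → sym (++-identityʳ (row T s)) } }

-- In a tableau extending P by m s letters c in row s, a letter x < c follows its path through P
-- until the row r where it ends in P; if m r > 0 it bumps the first c of that row, which then ends
-- one row lower.  bumpMax m r and bumpEnd m r are the resulting counts and end row.
bumpMax₀ : ℕ → (ℕ → ℕ) → ℕ → ℕ
bumpMax₀ zero    m s             = m s
bumpMax₀ (suc a) m zero          = a
bumpMax₀ (suc a) m (suc zero)    = suc (m 1)
bumpMax₀ (suc a) m (suc (suc s)) = m (suc (suc s))

bumpMax : (ℕ → ℕ) → ℕ → ℕ → ℕ
bumpMax m zero    s       = bumpMax₀ (m 0) m s
bumpMax m (suc r) zero    = m 0
bumpMax m (suc r) (suc s) = bumpMax (λ t → m (suc t)) r s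

bumpEnd : (ℕ → ℕ) → ℕ → ℕ
bumpEnd m r with m r
... | zero  = r
... | suc _ = suc r

bumpEnd-suc : ∀ m r → bumpEnd m (suc r) ≡ suc (bumpEnd (λ t → m (suc t)) r)
bumpEnd-suc m r with m (suc r)
... | zero  = refl
... | suc _ = refl

bumpEnd-unbumped : ∀ m {r} → m r ≡ 0 → bumpEnd m r ≡ r
bumpEnd-unbumped m {r} mr with m r
bumpEnd-unbumped m refl | zero = refl

bumpMax-unbumped : ∀ m r s → m r ≡ 0 → bumpMax m r s ≡ m s
bumpMax-unbumped m zero    s       m₀ rewrite m₀ = refl
bumpMax-unbumped m (suc r) zero    _  = refl
bumpMax-unbumped m (suc r) (suc s) mr = bumpMax-unbumped (λ t → m (suc t)) r s mr

bumpMax-here : ∀ m r {a} → m r ≡ suc a → bumpMax m r r ≡ a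
bumpMax-here m zero    m₀ rewrite m₀ = refl
bumpMax-here m (suc r) mr = bumpMax-here (λ t → m (suc t)) r mr

bumpMax-next : ∀ m r {a} → m r ≡ suc a → bumpMax m r (suc r) ≡ suc (m (suc r))
bumpMax-next m zero    m₀ rewrite m₀ = refl
bumpMax-next m (suc r) mr = bumpMax-next (λ t → m (suc t)) r mr

bumpMax-other : ∀ m r s {a} → m r ≡ suc a → s ≢ r → s ≢ suc r → bumpMax m r s ≡ m s
bumpMax-other m zero    zero          m₀ s≢r _ = ⊥-elim (s≢r refl)
bumpMax-other m zero    (suc zero)    m₀ _ s≢1 = ⊥-elim (s≢1 refl)
bumpMax-other m zero    (suc (suc s)) m₀ _ _ rewrite m₀ = refl
bumpMax-other m (suc r) zero          mr _ _ = refl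
bumpMax-other m (suc r) (suc s)       mr s≢r s≢1+r =
  bumpMax-other (λ t → m (suc t)) r s mr (s≢r ∘ cong suc) (s≢1+r ∘ cong suc)

mutual
  insert-Extends : ∀ c x P m T → x < c → AllEntries (_< c) P → Extends c P m T →
    Extends c (insert x P) (bumpMax m (endRow x P)) (insert x T) × endRow x T ≡ bumpEnd m (endRow x P)
  insert-Extends c x [] m [] x<c _ P[] = extends , sym (bumpEnd-unbumped m m₀)
    where
    m₀ = proj₂ (Extends-[] P[] 0)
    extends : Extends c ((x ∷ []) ∷ []) (bumpMax m 0) ((x ∷ []) ∷ [])
    extends = Extends-cong (λ s → sym (trans (bumpMax-unbumped m 0 s m₀) (proj₂ (Extends-[] P[] s))))
                           (Extends-refl c _)
  insert-Extends c x (p ∷ ps) m [] x<c _ P[] with proj₁ (Extends-[] P[] 0)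
  ... | refl = extends , sym (bumpEnd-unbumped m m₀)
    where
    m₀ = proj₂ (Extends-[] P[] 0)
    extends : Extends c ((x ∷ []) ∷ ps) (bumpMax m 0) ((x ∷ []) ∷ [])
    extends .rows zero rewrite bumpMax-unbumped m 0 0 m₀ | m₀ = refl
    extends .rows (suc s) rewrite bumpMax-unbumped m 0 (suc s) m₀ | proj₁ (Extends-[] P[] (suc s))
                          | proj₂ (Extends-[] P[] (suc s)) = refl
  insert-Extends c x [] m (t ∷ ts) x<c [] PT =
    insert-Extends-row c x [] [] m t ts x<c [] [] (PT .rows 0) (record { rows = PT .rows ∘ suc })
  insert-Extends c x (p ∷ ps) m (t ∷ ts) x<c (p<c ∷ ps<c) PT =
    insert-Extends-row c x p ps m t ts x<c p<c ps<c (PT .rows 0) (record { rows = PT .rows ∘ suc })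

  insert-Extends-row : ∀ c x p ps m t ts → x < c → All (_< c) p → AllEntries (_< c) ps →
    t ≡ p ++ replicate (m 0) c → Extends c ps (m ∘ suc) ts →
    Extends c (insert x (p ∷ ps)) (bumpMax m (endRow x (p ∷ ps))) (insert x (t ∷ ts))
      × endRow x (t ∷ ts) ≡ bumpEnd m (endRow x (p ∷ ps))
  insert-Extends-row c x p ps m t ts x<c p<c ps<c refl PT with rowInsert x p in eq
  ... | just y , p' rewrite rowInsert-++-just x p (replicate (m 0) c) eq =
    extends , trans (cong suc (proj₂ rest)) (sym (bumpEnd-suc m (endRow y ps)))
    where
    rest = insert-Extends c y ps (m ∘ suc) ts (All.lookup p<c (proj₂ (rowInsert-just x p eq))) ps<c PT
    extends : Extends c (p' ∷ insert y ps) (bumpMax m (suc (endRow y ps)))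
                        ((p' ++ replicate (m 0) c) ∷ insert y ts)
    extends .rows zero = refl
    extends .rows (suc s) = proj₁ rest .rows s
  ... | nothing , p' with proj₁ (rowInsert-nothing x p eq) | m 0 in m₀
  ...   | refl | zero rewrite rowInsert-++-nothing x p [] eq = extends , refl
    where
    extends : Extends c ((p ++ [ x ]) ∷ ps) m ((p ++ [ x ]) ∷ ts)
    extends .rows zero rewrite m₀ = sym (++-identityʳ _)
    extends .rows (suc s) = PT .rows s
  ...   | refl | suc a rewrite rowInsert-++-replicate x p c a eq x<c =
    extends , cong suc (proj₁ max)
    where
    max = insert-max c ts (Extends-row₀ PT (All.map (All.map <⇒≤) ps<c))
    ps-extends = Extends-trans PT (proj₂ max)
    extends : Extends c ((p ++ [ x ]) ∷ ps) (bumpMax₀ (suc a) m) ((p ++ x ∷ replicate a c) ∷ insert c ts)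
    extends .rows zero = sym (++-assoc p [ x ] (replicate a c))
    extends .rows (suc zero) rewrite ps-extends .rows 0 =
      cong (λ k → row ps 0 ++ replicate k c) (+-comm (m 1) 1)
    extends .rows (suc (suc s)) rewrite ps-extends .rows (suc s) =
      cong (λ k → row ps (suc s) ++ replicate k c) (+-identityʳ _)

insertAll : List ℕ → Tableau → Tableau
insertAll u T = foldl (λ U x → insert x U) T u

endRows : List ℕ → Tableau → List ℕ
endRows []      T = []
endRows (x ∷ u) T = endRow x T ∷ endRows u (insert x T)

insertAll-++ : ∀ u v T → insertAll (u ++ v) T ≡ insertAll v (insertAll u T)
insertAll-++ u v T = foldl-++ (λ U x → insert x U) T u v

insertAll-AllEntries : ∀ {P : ℕ → Set} u T → All P u → AllEntries P T → AllEntries P (insertAll u T)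
insertAll-AllEntries []      T []        pT = pT
insertAll-AllEntries (x ∷ u) T (px ∷ pu) pT = insertAll-AllEntries u (insert x T) pu (insert-AllEntries x T px pT)

insertAll-RowsSorted : ∀ u T → RowsSorted T → RowsSorted (insertAll u T)
insertAll-RowsSorted []      T sT = sT
insertAll-RowsSorted (x ∷ u) T sT = insertAll-RowsSorted u (insert x T) (insert-RowsSorted x T sT)

insertAll-NoEmptyRows : ∀ u T → NoEmptyRows T → NoEmptyRows (insertAll u T)
insertAll-NoEmptyRows []      T neT = neT
insertAll-NoEmptyRows (x ∷ u) T neT = insertAll-NoEmptyRows u (insert x T) (insert-NoEmptyRows x T neT)

occ : List ℕ → ℕ → ℕ
occ []       s = 0
occ (r ∷ rs) s = δ r s + occ rs s

insertAll-rowLength : ∀ u T s → rowLength (insertAll u T) s ≡ rowLength T s + occ (endRows u T) s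
insertAll-rowLength []      T s = sym (+-identityʳ _)
insertAll-rowLength (x ∷ u) T s = begin
  rowLength (insertAll u (insert x T)) s            ≡⟨ insertAll-rowLength u (insert x T) s ⟩
  rowLength (insert x T) s + occ rs s               ≡⟨ cong (_+ occ rs s) (insert-rowLength x T s) ⟩
  rowLength T s + δ (endRow x T) s + occ rs s       ≡⟨ +-assoc (rowLength T s) _ _ ⟩
  rowLength T s + occ (endRows (x ∷ u) T) s         ∎
  where
  open ≡-Reasoning
  rs = endRows u (insert x T)

endRows-bounded : ∀ x u T → All (x ≤_) u → Sorted u → RowsSorted T →
  All (_≤ endRow x T) (endRows u (insert x T))
endRows-bounded x []      T []          []         sT = []
endRows-bounded x (y ∷ u) T (x≤y ∷ x≤u) (y≤u ∷ su) sT =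
  y-below ∷ All.map (flip ≤-trans y-below) (endRows-bounded y u (insert x T) y≤u su (insert-RowsSorted x T sT))
  where y-below = rowBumping x y T sT x≤y

endRows-antitone : ∀ u T → Sorted u → RowsSorted T → AllPairs _≥_ (endRows u T)
endRows-antitone []      T []         sT = []
endRows-antitone (x ∷ u) T (x≤u ∷ su) sT =
  endRows-bounded x u T x≤u su sT ∷ endRows-antitone u (insert x T) su (insert-RowsSorted x T sT)

bumpMaxAll : (ℕ → ℕ) → List ℕ → ℕ → ℕ
bumpMaxAll m []       = m
bumpMaxAll m (r ∷ rs) = bumpMaxAll (bumpMax m r) rs

insertAll-Extends : ∀ c u P m T → All (_< c) u → AllEntries (_< c) P → Extends c P m T →
  Extends c (insertAll u P) (bumpMaxAll m (endRows u P)) (insertAll u T)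
insertAll-Extends c []      P m T []          P<c PT = PT
insertAll-Extends c (x ∷ u) P m T (x<c ∷ u<c) P<c PT =
  insertAll-Extends c u (insert x P) _ (insert x T) u<c (insert-AllEntries x P x<c P<c)
                    (proj₁ (insert-Extends c x P m T x<c P<c PT))

insertAll-max : ∀ c a T → All (_≤ c) (row T 0) → Extends c T (λ s → a * δ 0 s) (insertAll (replicate a c) T)
insertAll-max c zero    T T≤c = Extends-refl c T
insertAll-max c (suc a) T T≤c =
  Extends-trans (proj₂ max) (insertAll-max c a (insert c T) (subst (All (_≤ c)) (sym (proj₂ max .rows 0)) T+c≤c))
  where
  max = insert-max c T T≤c
  T+c≤c = ++⁺ T≤c (≤-refl ∷ [])

shiftedMin : (ℕ → ℕ) → (ℕ → ℕ) → ℕ → ℕ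
shiftedMin f g zero    = 0
shiftedMin f g (suc s) = f s ⊓ g s

shiftedMin-cong : ∀ {f g f' g'} s → (∀ t → s ≡ suc t → f t ≡ f' t × g t ≡ g' t) →
  shiftedMin f g s ≡ shiftedMin f' g' s
shiftedMin-cong zero    _  = refl
shiftedMin-cong (suc t) eq = cong₂ _⊓_ (proj₁ (eq t refl)) (proj₂ (eq t refl))

occ-above : ∀ rs r s → All (_≤ r) rs → r < s → occ rs s ≡ 0
occ-above []       r s []           r<s = refl
occ-above (q ∷ rs) r s (q≤r ∷ rs≤r) r<s
  rewrite δ-≢ q s (<⇒≢ (≤-<-trans q≤r r<s)) = occ-above rs r s rs≤r r<s

n≢1+n : ∀ {n} → n ≢ suc n
n≢1+n ()

n≢2+n : ∀ {n} → n ≢ suc (suc n)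
n≢2+n ()

occ-∷-≢ : ∀ r rs t → r ≢ t → occ rs t ≡ occ (r ∷ rs) t
occ-∷-≢ r rs t r≢t = sym (cong (_+ occ rs t) (δ-≢ r t r≢t))

pred-≢ : ∀ {r s t} → s ≢ suc r → s ≡ suc t → r ≢ t
pred-≢ s≢1+r s≡1+t r≡t = s≢1+r (trans s≡1+t (cong suc (sym r≡t)))

bumpMax-step-unbumped : ∀ m r rs → All (_≤ r) rs → m r ≡ 0 → ∀ s →
  δ r s + ((bumpMax m r s ⊔ occ rs s) + shiftedMin (bumpMax m r) (occ rs) s)
    ≡ (m s ⊔ occ (r ∷ rs) s) + shiftedMin m (occ (r ∷ rs)) s
bumpMax-step-unbumped m r rs rs≤r mr s
  rewrite bumpMax-unbumped m r s mr
        | shiftedMin-cong {bumpMax m r} {occ rs} {m} {occ rs} s (λ t _ → bumpMax-unbumped m r t mr , refl)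
  with s ≟ r
... | yes refl rewrite δ-refl r | mr
  | shiftedMin-cong {m} {occ rs} {m} {occ (r ∷ rs)} r (λ t eq → refl , occ-∷-≢ r rs t (pred-≢ n≢1+n eq))
  = refl
... | no s≢r with s ≟ suc r
...   | yes refl rewrite δ-≢ r (suc r) n≢1+n | occ-above rs r (suc r) rs≤r ≤-refl | mr = refl
...   | no s≢1+r rewrite δ-≢ r s (s≢r ∘ sym)
  | shiftedMin-cong {m} {occ rs} {m} {occ (r ∷ rs)} s (λ t eq → refl , occ-∷-≢ r rs t (pred-≢ s≢1+r eq))
  = refl

bumpMax-step-bumped : ∀ m r rs {a} → All (_≤ r) rs → m r ≡ suc a → ∀ s →
  δ r s + ((bumpMax m r s ⊔ occ rs s) + shiftedMin (bumpMax m r) (occ rs) s)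
    ≡ (m s ⊔ occ (r ∷ rs) s) + shiftedMin m (occ (r ∷ rs)) s
bumpMax-step-bumped m r rs {a} rs≤r mr s with s ≟ r
... | yes refl rewrite δ-refl r | bumpMax-here m r mr | mr
  | shiftedMin-cong {bumpMax m r} {occ rs} {m} {occ (r ∷ rs)} r (λ t eq →
      bumpMax-other m r t mr (n≢1+n ∘ flip trans eq) (n≢2+n ∘ flip trans (cong suc eq)) ,
      occ-∷-≢ r rs t (pred-≢ n≢1+n eq)) = refl
... | no s≢r with s ≟ suc r
...   | yes refl rewrite δ-≢ r (suc r) n≢1+n | occ-above rs r (suc r) rs≤r ≤-refl
        | bumpMax-next m r mr | bumpMax-here m r mr | δ-refl r | mr | ⊔-identityʳ (m (suc r)) =
  sym (+-suc (m (suc r)) (a ⊓ occ rs r))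
...   | no s≢1+r with s ≟ suc (suc r)
...     | yes refl rewrite δ-≢ r (suc (suc r)) (n≢2+n) | δ-≢ r (suc r) n≢1+n
          | occ-above rs r (suc (suc r)) rs≤r (m≤n⇒m≤1+n ≤-refl) | occ-above rs r (suc r) rs≤r ≤-refl
          | bumpMax-other m r (suc (suc r)) mr (n≢2+n ∘ sym) (n≢1+n ∘ sym)
          | ⊓-zeroʳ (bumpMax m r (suc r)) | ⊓-zeroʳ (m (suc r)) = refl
...     | no s≢2+r rewrite δ-≢ r s (s≢r ∘ sym) | bumpMax-other m r s mr s≢r s≢1+r
          | shiftedMin-cong {bumpMax m r} {occ rs} {m} {occ (r ∷ rs)} s (λ t eq →
              bumpMax-other m r t mr (pred-≢ s≢1+r eq ∘ sym) (pred-≢ s≢2+r eq ∘ sym) ,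
              occ-∷-≢ r rs t (pred-≢ s≢1+r eq)) = refl

bumpMax-step : ∀ m r rs → All (_≤ r) rs → ∀ s →
  δ r s + ((bumpMax m r s ⊔ occ rs s) + shiftedMin (bumpMax m r) (occ rs) s)
    ≡ (m s ⊔ occ (r ∷ rs) s) + shiftedMin m (occ (r ∷ rs)) s
bumpMax-step m r rs rs≤r s with m r in mr
... | zero  = bumpMax-step-unbumped m r rs rs≤r mr s
... | suc a = bumpMax-step-bumped m r rs rs≤r mr s

occ+bumpMaxAll : ∀ m rs → AllPairs _≥_ rs → ∀ s →
  occ rs s + bumpMaxAll m rs s ≡ (m s ⊔ occ rs s) + shiftedMin m (occ rs) s
occ+bumpMaxAll m [] [] zero rewrite ⊔-identityʳ (m 0) = sym (+-identityʳ _)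
occ+bumpMaxAll m [] [] (suc s) rewrite ⊔-identityʳ (m (suc s)) | ⊓-zeroʳ (m s) = sym (+-identityʳ _)
occ+bumpMaxAll m (r ∷ rs) (rs≤r ∷ rs↓) s = begin
  δ r s + occ rs s + bumpMaxAll (bumpMax m r) rs s
    ≡⟨ +-assoc (δ r s) _ _ ⟩
  δ r s + (occ rs s + bumpMaxAll (bumpMax m r) rs s)
    ≡⟨ cong (δ r s +_) (occ+bumpMaxAll (bumpMax m r) rs rs↓ s) ⟩
  δ r s + ((bumpMax m r s ⊔ occ rs s) + shiftedMin (bumpMax m r) (occ rs) s)
    ≡⟨ bumpMax-step m r rs rs≤r s ⟩
  (m s ⊔ occ (r ∷ rs) s) + shiftedMin m (occ (r ∷ rs)) s ∎
  where open ≡-Reasoning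

-- The growth diagram of Φ

Symmetricℕ : (ℕ → ℕ → ℕ) → Set
Symmetricℕ f = ∀ i j → f i j ≡ f j i

-- Indices start at 0, and column j contributes the letter j + 1.
rowWord : (ℕ → ℕ → ℕ) → ℕ → ℕ → List ℕ
rowWord f i zero    = []
rowWord f i (suc k) = rowWord f i k ++ replicate (f i k) (suc k)

word : (ℕ → ℕ → ℕ) → ℕ → ℕ → List ℕ
word f zero    k = []
word f (suc i) k = word f i k ++ rowWord f i k

P : (ℕ → ℕ → ℕ) → ℕ → ℕ → Tableau
P f i k = insertAll (word f i k) []

shape : (ℕ → ℕ → ℕ) → ℕ → ℕ → ℕ → ℕ
shape f i k = rowLength (P f i k)

rowWord-bounded : ∀ f i k → All (_< suc k) (rowWord f i k)
rowWord-bounded f i zero    = []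
rowWord-bounded f i (suc k) = ++⁺ (All.map m≤n⇒m≤1+n (rowWord-bounded f i k)) (replicate⁺ (f i k) ≤-refl)

replicate-sorted : ∀ a c → Sorted (replicate a c)
replicate-sorted zero    c = []
replicate-sorted (suc a) c = replicate⁺ a ≤-refl ∷ replicate-sorted a c

rowWord-sorted : ∀ f i k → Sorted (rowWord f i k)
rowWord-sorted f i zero    = []
rowWord-sorted f i (suc k) = AllPairs.++⁺ (rowWord-sorted f i k) (replicate-sorted (f i k) (suc k))
  (All.map (λ x<1+k → replicate⁺ (f i k) (<⇒≤ x<1+k)) (rowWord-bounded f i k))

word-bounded : ∀ f i k → All (_< suc k) (word f i k)
word-bounded f zero    k = []
word-bounded f (suc i) k = ++⁺ (word-bounded f i k) (rowWord-bounded f i k)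

P-bounded : ∀ f i k → AllEntries (_< suc k) (P f i k)
P-bounded f i k = insertAll-AllEntries (word f i k) [] (word-bounded f i k) []

P-RowsSorted : ∀ f i k → RowsSorted (P f i k)
P-RowsSorted f i k = insertAll-RowsSorted (word f i k) [] []

P-NoEmptyRows : ∀ f i k → NoEmptyRows (P f i k)
P-NoEmptyRows f i k = insertAll-NoEmptyRows (word f i k) [] []

P-suc : ∀ f i k → P f (suc i) k ≡ insertAll (rowWord f i k) (P f i k)
P-suc f i k = insertAll-++ (word f i k) (rowWord f i k) []

endRowsP : (ℕ → ℕ → ℕ) → ℕ → ℕ → List ℕ
endRowsP f i k = endRows (rowWord f i k) (P f i k)

-- The number of letters k + 1 in row s of P f i (k + 1).
markers : (ℕ → ℕ → ℕ) → ℕ → ℕ → ℕ → ℕ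
markers f zero    k s = 0
markers f (suc i) k s = bumpMaxAll (markers f i k) (endRowsP f i k) s + f i k * δ 0 s

P-Extends : ∀ f i k → Extends (suc k) (P f i k) (markers f i k) (P f i (suc k))
P-Extends f zero    k = Extends-refl (suc k) []
P-Extends f (suc i) k rewrite P-suc f i (suc k) | P-suc f i k
                            | insertAll-++ (rowWord f i k) (replicate (f i k) (suc k)) (P f i (suc k)) =
  Extends-trans strip (insertAll-max (suc k) (f i k) _ (Extends-row₀ strip (All.map (All.map <⇒≤) bounded)))
  where
  bounded = insertAll-AllEntries (rowWord f i k) (P f i k) (rowWord-bounded f i k) (P-bounded f i k)
  strip = insertAll-Extends (suc k) (rowWord f i k) (P f i k) (markers f i k) (P f i (suc k))
            (rowWord-bounded f i k) (P-bounded f i k) (P-Extends f i k)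

shape-suc : ∀ f i k s → shape f (suc i) k s ≡ shape f i k s + occ (endRowsP f i k) s
shape-suc f i k s =
  trans (cong (λ T → rowLength T s) (P-suc f i k)) (insertAll-rowLength (rowWord f i k) (P f i k) s)

-- Fomin's local rule for RSK growth diagrams, in terms of row lengths.
localRule : (ℕ → ℕ) → (ℕ → ℕ) → (ℕ → ℕ) → ℕ → ℕ → ℕ
localRule μ λ₁ λ₂ a s =
  μ s + (((λ₁ s ∸ μ s) ⊔ (λ₂ s ∸ μ s)) + shiftedMin (λ t → λ₁ t ∸ μ t) (λ t → λ₂ t ∸ μ t) s)
      + a * δ 0 s

shape-localRule : ∀ f i k s →
  shape f (suc i) (suc k) s ≡ localRule (shape f i k) (shape f i (suc k)) (shape f (suc i) k) (f i k) s
shape-localRule f i k s = begin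
  shape f (suc i) (suc k) s
    ≡⟨ Extends-rowLength (P-Extends f (suc i) k) s ⟩
  shape f (suc i) k s + (bumpMaxAll m hits s + f i k * δ 0 s)
    ≡⟨ cong (_+ (bumpMaxAll m hits s + f i k * δ 0 s)) (shape-suc f i k s) ⟩
  μ s + occ hits s + (bumpMaxAll m hits s + f i k * δ 0 s)
    ≡⟨ +-assoc (μ s + occ hits s) _ _ ⟨
  μ s + occ hits s + bumpMaxAll m hits s + f i k * δ 0 s
    ≡⟨ cong (_+ f i k * δ 0 s) (+-assoc (μ s) _ _) ⟩
  μ s + (occ hits s + bumpMaxAll m hits s) + f i k * δ 0 s
    ≡⟨ cong (λ n → μ s + n + f i k * δ 0 s) (occ+bumpMaxAll m hits hits↓ s) ⟩
  μ s + ((m s ⊔ occ hits s) + shiftedMin m (occ hits) s) + f i k * δ 0 s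
    ≡⟨ cong (λ n → μ s + n + f i k * δ 0 s) (cong₂ _+_ (cong₂ _⊔_ (markers≡ s) (occ≡ s))
                                                          (shiftedMin-cong s (λ t _ → markers≡ t , occ≡ t))) ⟨
  localRule μ (shape f i (suc k)) (shape f (suc i) k) (f i k) s ∎
  where
  open ≡-Reasoning
  μ = shape f i k
  m = markers f i k
  hits = endRowsP f i k
  hits↓ = endRows-antitone (rowWord f i k) (P f i k) (rowWord-sorted f i k) (P-RowsSorted f i k)
  markers≡ : ∀ t → shape f i (suc k) t ∸ μ t ≡ m t
  markers≡ t = trans (cong (_∸ μ t) (Extends-rowLength (P-Extends f i k) t)) (m+n∸m≡n (μ t) (m t))
  occ≡ : ∀ t → shape f (suc i) k t ∸ μ t ≡ occ hits t
  occ≡ t = trans (cong (_∸ μ t) (shape-suc f i k t)) (m+n∸m≡n (μ t) (occ hits t))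

localRule-comm : ∀ μ λ₁ λ₂ a s → localRule μ λ₁ λ₂ a s ≡ localRule μ λ₂ λ₁ a s
localRule-comm μ λ₁ λ₂ a zero    rewrite ⊔-comm (λ₁ 0 ∸ μ 0) (λ₂ 0 ∸ μ 0) = refl
localRule-comm μ λ₁ λ₂ a (suc s) rewrite ⊔-comm (λ₁ (suc s) ∸ μ (suc s)) (λ₂ (suc s) ∸ μ (suc s))
                                       | ⊓-comm (λ₁ s ∸ μ s) (λ₂ s ∸ μ s) = refl

localRule-cong : ∀ {μ λ₁ λ₂ μ' λ₁' λ₂'} a s →
  (∀ t → μ t ≡ μ' t) → (∀ t → λ₁ t ≡ λ₁' t) → (∀ t → λ₂ t ≡ λ₂' t) →
  localRule μ λ₁ λ₂ a s ≡ localRule μ' λ₁' λ₂' a s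
localRule-cong a zero    eq eq₁ eq₂ rewrite eq 0 | eq₁ 0 | eq₂ 0 = refl
localRule-cong a (suc s) eq eq₁ eq₂
  rewrite eq s | eq₁ s | eq₂ s | eq (suc s) | eq₁ (suc s) | eq₂ (suc s) = refl

word-zero : ∀ f i → word f i 0 ≡ []
word-zero f zero    = refl
word-zero f (suc i) rewrite word-zero f i = refl

shape-zero : ∀ f i s → shape f i 0 s ≡ 0
shape-zero f i s rewrite word-zero f i = refl

shape-transpose : ∀ f → Symmetricℕ f → ∀ i k s → shape f i k s ≡ shape f k i s
shape-transpose f f-sym zero    k       s = sym (shape-zero f k s)
shape-transpose f f-sym (suc i) zero    s = shape-zero f (suc i) s
shape-transpose f f-sym (suc i) (suc k) s = begin
  shape f (suc i) (suc k) s
    ≡⟨ shape-localRule f i k s ⟩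
  localRule (shape f i k) (shape f i (suc k)) (shape f (suc i) k) (f i k) s
    ≡⟨ cong (λ a → localRule (shape f i k) (shape f i (suc k)) (shape f (suc i) k) a s) (f-sym i k) ⟩
  localRule (shape f i k) (shape f i (suc k)) (shape f (suc i) k) (f k i) s
    ≡⟨ localRule-cong (f k i) s (shape-transpose f f-sym i k) (shape-transpose f f-sym i (suc k))
                                (shape-transpose f f-sym (suc i) k) ⟩
  localRule (shape f k i) (shape f (suc k) i) (shape f k (suc i)) (f k i) s
    ≡⟨ localRule-comm (shape f k i) (shape f (suc k) i) (shape f k (suc i)) (f k i) s ⟩
  localRule (shape f k i) (shape f k (suc i)) (shape f (suc k) i) (f k i) s
    ≡⟨ shape-localRule f k i s ⟨
  shape f (suc k) (suc i) s ∎
  where open ≡-Reasoning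

-- The construction Ψ

psiStep-< : ∀ T c x → x < c → psiStep T (c , x) ≡ placeAt (suc (endRow x T)) c (insert x T)
psiStep-< T c x x<c with rsk x T
... | _ rewrite <⇒<ᵇ≡true x<c = refl

psiStep-diagonal : ∀ T c → psiStep T (c , c) ≡ insert c T
psiStep-diagonal T c with rsk c T
... | _ rewrite ≥⇒<ᵇ≡false {c} {c} ≤-refl = refl

psiSteps-diagonal : ∀ a c T → foldl psiStep T (replicate a (c , c)) ≡ insertAll (replicate a c) T
psiSteps-diagonal zero    c T = refl
psiSteps-diagonal (suc a) c T rewrite psiStep-diagonal T c = psiSteps-diagonal a c (insert c T)

placeAt-Extends : ∀ k c T → k ≤ length T → Extends c T (δ k) (placeAt k c T)
placeAt-Extends zero    c []      _         .rows zero    = refl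
placeAt-Extends zero    c []      _         .rows (suc s) = refl
placeAt-Extends zero    c (R ∷ T) _         .rows zero    = refl
placeAt-Extends zero    c (R ∷ T) _         .rows (suc s) = sym (++-identityʳ _)
placeAt-Extends (suc k) c (R ∷ T) _         .rows zero    = sym (++-identityʳ _)
placeAt-Extends (suc k) c (R ∷ T) (s≤s k≤n) .rows (suc s) = placeAt-Extends k c T k≤n .rows s

placeAt-NoEmptyRows : ∀ k c T → k ≤ length T → NoEmptyRows T → NoEmptyRows (placeAt k c T)
placeAt-NoEmptyRows zero    c []      _         []          = (λ ()) ∷ []
placeAt-NoEmptyRows zero    c (R ∷ T) _         (R≢[] ∷ neT) = (R≢[] ∘ ++-conicalˡ R [ c ]) ∷ neT
placeAt-NoEmptyRows (suc k) c (R ∷ T) (s≤s k≤n) (R≢[] ∷ neT) = R≢[] ∷ placeAt-NoEmptyRows k c T k≤n neT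

row-injective : ∀ T U → NoEmptyRows T → NoEmptyRows U → (∀ s → row T s ≡ row U s) → T ≡ U
row-injective []      []      _           _           _  = refl
row-injective []      (R ∷ U) _           (R≢[] ∷ _)  eq = ⊥-elim (R≢[] (sym (eq 0)))
row-injective (R ∷ T) []      (R≢[] ∷ _)  _           eq = ⊥-elim (R≢[] (eq 0))
row-injective (R ∷ T) (S ∷ U) (_ ∷ neT)   (_ ∷ neU)   eq =
  cong₂ _∷_ (eq 0) (row-injective T U neT neU (eq ∘ suc))

insert-Extends-unbumped : ∀ c x P m T → x < c → AllEntries (_< c) P → Extends c P m T →
  m (endRow x P) ≡ 0 →
  Extends c (insert x P) m (insert x T) × endRow x T ≡ endRow x P
insert-Extends-unbumped c x P m T x<c P<c PT unmarked =
  Extends-cong (λ s → bumpMax-unbumped m (endRow x P) s unmarked) (proj₁ step) ,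
  trans (proj₂ step) (bumpEnd-unbumped m unmarked)
  where step = insert-Extends c x P m T x<c P<c PT

psiStep-Extends : ∀ c x P m T → x < c → AllEntries (_< c) P → Extends c P m T → NoEmptyRows T →
  m (endRow x P) ≡ 0 →
  Extends c (insert x P) (λ s → m s + δ (suc (endRow x P)) s) (psiStep T (c , x))
    × NoEmptyRows (psiStep T (c , x))
psiStep-Extends c x P m T x<c P<c PT neT unmarked
  with insert-Extends-unbumped c x P m T x<c P<c PT unmarked
... | PT' , end≡ rewrite psiStep-< T c x x<c | end≡ =
  Extends-trans PT' (placeAt-Extends _ c (insert x T) fits) ,
  placeAt-NoEmptyRows _ c (insert x T) fits (insert-NoEmptyRows x T neT)
  where
  fits : suc (endRow x P) ≤ length (insert x T)
  fits = subst (λ r → suc r ≤ length (insert x T)) end≡ (endRow<length x T)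

-- The end rows of a weakly increasing word weakly decrease, so every insertion ends in a row that
-- holds no letter c yet and bumps none.
UnmarkedUpTo : (ℕ → ℕ) → List ℕ → Set
UnmarkedUpTo m = All (λ r → ∀ s → s ≤ r → m s ≡ 0)

UnmarkedUpTo-zero : ∀ rs → UnmarkedUpTo (λ _ → 0) rs
UnmarkedUpTo-zero = All.universal (λ _ _ _ → refl)

UnmarkedUpTo-mark : ∀ m r rs → UnmarkedUpTo m rs → All (_≤ r) rs → UnmarkedUpTo (λ s → m s + δ (suc r) s) rs
UnmarkedUpTo-mark m r []       []          []         = []
UnmarkedUpTo-mark m r (q ∷ rs) (mq ∷ mrs) (q≤r ∷ rs≤r) =
  (λ s s≤q → cong₂ _+_ (mq s s≤q) (δ-≢ (suc r) s (λ { refl → <⇒≱ (s≤s q≤r) s≤q })))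
  ∷ UnmarkedUpTo-mark m r rs mrs rs≤r

psiSteps-Extends : ∀ c u P m T → All (_< c) u → AllEntries (_< c) P → Extends c P m T → NoEmptyRows T →
  AllPairs _≥_ (endRows u P) → UnmarkedUpTo m (endRows u P) →
  Extends c (insertAll u P) (λ s → m s + occ (map suc (endRows u P)) s) (foldl psiStep T (map (c ,_) u))
    × NoEmptyRows (foldl psiStep T (map (c ,_) u))
psiSteps-Extends c []      P m T []          P<c PT neT []         []        =
  Extends-cong (λ s → sym (+-identityʳ (m s))) PT , neT
psiSteps-Extends c (x ∷ u) P m T (x<c ∷ u<c) P<c PT neT (r≥ ∷ rs↓) (mr ∷ mrs)
  with psiStep-Extends c x P m T x<c P<c PT neT (mr _ ≤-refl)
... | PT' , neT' with psiSteps-Extends c u (insert x P) _ (psiStep T (c , x)) u<c (insert-AllEntries x P x<c P<c)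
                        PT' neT' rs↓ (UnmarkedUpTo-mark m (endRow x P) _ mrs r≥)
... | PU , neU = Extends-cong (λ s → +-assoc (m s) _ _) PU , neU

occ-map-suc-zero : ∀ rs → occ (map suc rs) 0 ≡ 0
occ-map-suc-zero []       = refl
occ-map-suc-zero (r ∷ rs) = occ-map-suc-zero rs

occ-map-suc : ∀ rs s → occ (map suc rs) (suc s) ≡ occ rs s
occ-map-suc []       s = refl
occ-map-suc (r ∷ rs) s = cong (δ r s +_) (occ-map-suc rs s)

shiftedMin-occ : ∀ rs s → shiftedMin (occ rs) (occ rs) s ≡ occ (map suc rs) s
shiftedMin-occ rs zero    = sym (occ-map-suc-zero rs)
shiftedMin-occ rs (suc s) = trans (⊓-idem (occ rs s)) (sym (occ-map-suc rs s))

localRule-diagonal : ∀ μ h a s →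
  localRule μ (λ t → μ t + h t) (λ t → μ t + h t) a s ≡ μ s + h s + (shiftedMin h h s + a * δ 0 s)
localRule-diagonal μ h a s = begin
  localRule μ ν ν a s
    ≡⟨ cong (λ n → μ s + (n + shiftedMin h′ h′ s) + a * δ 0 s) (trans (⊔-idem _) (h′≡h s)) ⟩
  μ s + (h s + shiftedMin h′ h′ s) + a * δ 0 s
    ≡⟨ cong (λ n → μ s + (h s + n) + a * δ 0 s) (shiftedMin-cong s (λ t _ → h′≡h t , h′≡h t)) ⟩
  μ s + (h s + shiftedMin h h s) + a * δ 0 s
    ≡⟨ cong (_+ a * δ 0 s) (+-assoc (μ s) _ _) ⟨
  μ s + h s + shiftedMin h h s + a * δ 0 s
    ≡⟨ +-assoc (μ s + h s) _ _ ⟩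
  μ s + h s + (shiftedMin h h s + a * δ 0 s) ∎
  where
  open ≡-Reasoning
  ν h′ : ℕ → ℕ
  ν t = μ t + h t
  h′ t = ν t ∸ μ t
  h′≡h : ∀ t → h′ t ≡ h t
  h′≡h t = m+n∸m≡n (μ t) (h t)

markers-diagonal : ∀ f → Symmetricℕ f → ∀ k s →
  markers f (suc k) k s ≡ occ (map suc (endRowsP f k k)) s + f k k * δ 0 s
markers-diagonal f f-sym k s = +-cancelˡ-≡ (ν s) _ _ (begin
  ν s + markers f (suc k) k s
    ≡⟨ Extends-rowLength (P-Extends f (suc k) k) s ⟨
  shape f (suc k) (suc k) s
    ≡⟨ shape-localRule f k k s ⟩
  localRule μ (shape f k (suc k)) ν (f k k) s
    ≡⟨ localRule-cong {μ = μ} {μ' = μ} (f k k) s (λ _ → refl) (λ t → trans (shape-transpose f f-sym k (suc k) t) (ν≡ t))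
                      ν≡ ⟩
  localRule μ (λ t → μ t + h t) (λ t → μ t + h t) (f k k) s
    ≡⟨ localRule-diagonal μ h (f k k) s ⟩
  μ s + h s + (shiftedMin h h s + f k k * δ 0 s)
    ≡⟨ cong₂ (λ m n → m + (n + f k k * δ 0 s)) (ν≡ s) (sym (shiftedMin-occ (endRowsP f k k) s)) ⟨
  ν s + (occ (map suc (endRowsP f k k)) s + f k k * δ 0 s) ∎)
  where
  open ≡-Reasoning
  μ ν h : ℕ → ℕ
  μ = shape f k k
  ν = shape f (suc k) k
  h = occ (endRowsP f k k)
  ν≡ : ∀ t → ν t ≡ μ t + h t
  ν≡ = shape-suc f k k

psiColumn : (ℕ → ℕ → ℕ) → ℕ → List (ℕ × ℕ)
psiColumn f k = map (suc k ,_) (rowWord f k k) ++ replicate (f k k) (suc k , suc k)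

psiColumn-step : ∀ f → Symmetricℕ f → ∀ k →
  foldl psiStep (P f k k) (psiColumn f k) ≡ P f (suc k) (suc k)
psiColumn-step f f-sym k = row-injective _ _ noEmpty (P-NoEmptyRows f (suc k) (suc k)) λ s → begin
  row Tψ s
    ≡⟨ ψ-extends .rows s ⟩
  row (P f (suc k) k) s ++ replicate (0 + occ (map suc hits) s + f k k * δ 0 s) (suc k)
    ≡⟨ cong (λ n → row (P f (suc k) k) s ++ replicate n (suc k)) (markers-diagonal f f-sym k s) ⟨
  row (P f (suc k) k) s ++ replicate (markers f (suc k) k s) (suc k)
    ≡⟨ P-Extends f (suc k) k .rows s ⟨
  row (P f (suc k) (suc k)) s ∎
  where
  open ≡-Reasoning
  u = rowWord f k k
  hits = endRowsP f k k
  strip = psiSteps-Extends (suc k) u (P f k k) (λ _ → 0) (P f k k) (rowWord-bounded f k k) (P-bounded f k k)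
            (Extends-refl (suc k) (P f k k)) (P-NoEmptyRows f k k)
            (endRows-antitone u (P f k k) (rowWord-sorted f k k) (P-RowsSorted f k k))
            (UnmarkedUpTo-zero hits)
  T₁ = foldl psiStep (P f k k) (map (suc k ,_) u)
  Tψ = foldl psiStep (P f k k) (psiColumn f k)
  Tψ≡ : Tψ ≡ insertAll (replicate (f k k) (suc k)) T₁
  Tψ≡ = trans (foldl-++ psiStep (P f k k) (map (suc k ,_) u) _) (psiSteps-diagonal (f k k) (suc k) T₁)
  ψ-extends : Extends (suc k) (P f (suc k) k) (λ s → 0 + occ (map suc hits) s + f k k * δ 0 s) Tψ
  ψ-extends rewrite Tψ≡ | P-suc f k k =
    Extends-trans (proj₁ strip) (insertAll-max (suc k) (f k k) T₁ (Extends-row₀ (proj₁ strip) (All.map (All.map <⇒≤) bounded)))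
    where bounded = insertAll-AllEntries u (P f k k) (rowWord-bounded f k k) (P-bounded f k k)
  noEmpty : NoEmptyRows Tψ
  noEmpty rewrite Tψ≡ = insertAll-NoEmptyRows (replicate (f k k) (suc k)) T₁ (proj₂ strip)

psiColumns : (ℕ → ℕ → ℕ) → ℕ → List (ℕ × ℕ)
psiColumns f zero    = []
psiColumns f (suc k) = psiColumns f k ++ psiColumn f k

psiColumns-P : ∀ f → Symmetricℕ f → ∀ k → foldl psiStep [] (psiColumns f k) ≡ P f k k
psiColumns-P f f-sym zero    = refl
psiColumns-P f f-sym (suc k) = begin
  foldl psiStep [] (psiColumns f k ++ psiColumn f k)
    ≡⟨ foldl-++ psiStep [] (psiColumns f k) (psiColumn f k) ⟩
  foldl psiStep (foldl psiStep [] (psiColumns f k)) (psiColumn f k)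
    ≡⟨ cong (λ T → foldl psiStep T (psiColumn f k)) (psiColumns-P f f-sym k) ⟩
  foldl psiStep (P f k k) (psiColumn f k)
    ≡⟨ psiColumn-step f f-sym k ⟩
  P f (suc k) (suc k) ∎
  where open ≡-Reasoning

-- Matrices and two-line arrays

-- Zero outside the n × n range.
entries : ∀ {n} → Matrix n → ℕ → ℕ → ℕ
entries {n} A i j with i <? n | j <? n
... | yes i<n | yes j<n = A (fromℕ< i<n) (fromℕ< j<n)
... | _       | _       = 0

entries-toℕ : ∀ {n} (A : Matrix n) i j → entries A (toℕ i) (toℕ j) ≡ A i j
entries-toℕ {n} A i j with toℕ i <? n | toℕ j <? n
... | yes i<n | yes j<n = cong₂ A (fromℕ<-toℕ i i<n) (fromℕ<-toℕ j j<n)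
... | no  i≮n | _       = ⊥-elim (i≮n (toℕ<n i))
... | yes _   | no  j≮n = ⊥-elim (j≮n (toℕ<n j))

entries-symmetric : ∀ {n} (A : Matrix n) → Symmetric A → Symmetricℕ (entries A)
entries-symmetric {n} A A-sym i j with i <? n | j <? n
... | yes i<n | yes j<n = A-sym (fromℕ< i<n) (fromℕ< j<n)
... | yes _   | no  _   = refl
... | no  _   | yes _   = refl
... | no  _   | no  _   = refl

concatMap-allFin : ∀ {B : Set} n (G : Fin n → List B) (H : ℕ → List B) → (∀ i → G i ≡ H (toℕ i)) →
  concatMap G (allFin n) ≡ concatMap H (upTo n)
concatMap-allFin n G H G≗H = cong concat (begin
  map G (allFin n)       ≡⟨ map-tabulate id G ⟩
  tabulate G             ≡⟨ tabulate-applyUpTo n G≗H ⟩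
  applyUpTo H n          ≡⟨ map-upTo H n ⟨
  map H (upTo n)         ∎)
  where
  open ≡-Reasoning
  tabulate-applyUpTo : ∀ n {G : Fin n → List _} {H} → (∀ i → G i ≡ H (toℕ i)) → tabulate G ≡ applyUpTo H n
  tabulate-applyUpTo zero    G≗H = refl
  tabulate-applyUpTo (suc n) G≗H = cong₂ _∷_ (G≗H Fin.zero) (tabulate-applyUpTo n (G≗H ∘ Fin.suc))

concatMap-upTo-suc : ∀ {B : Set} (H : ℕ → List B) k →
  concatMap H (upTo (suc k)) ≡ concatMap H (upTo k) ++ H k
concatMap-upTo-suc H k = begin
  concatMap H (upTo (suc k))           ≡⟨ cong (concatMap H) (upTo-∷ʳ k) ⟨
  concatMap H (upTo k ++ [ k ])        ≡⟨ concatMap-++ H (upTo k) [ k ] ⟩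
  concatMap H (upTo k) ++ H k ++ []    ≡⟨ cong (concatMap H (upTo k) ++_) (++-identityʳ (H k)) ⟩
  concatMap H (upTo k) ++ H k          ∎
  where open ≡-Reasoning

rowWord-upTo : ∀ f i k → concatMap (λ j → replicate (f i j) (suc j)) (upTo k) ≡ rowWord f i k
rowWord-upTo f i zero    = refl
rowWord-upTo f i (suc k) =
  trans (concatMap-upTo-suc _ k) (cong (_++ replicate (f i k) (suc k)) (rowWord-upTo f i k))

word-upTo : ∀ f i k → concatMap (λ i' → rowWord f i' k) (upTo i) ≡ word f i k
word-upTo f zero    k = refl
word-upTo f (suc i) k = trans (concatMap-upTo-suc _ i) (cong (_++ rowWord f i k) (word-upTo f i k))

phiWord≡word : ∀ {n} (A : Matrix n) → phiWord A ≡ word (entries A) n n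
phiWord≡word {n} A =
  trans (concatMap-allFin n _ (λ i → rowWord (entries A) i n) λ i →
           trans (concatMap-allFin n _ (λ j → replicate (entries A (toℕ i) j) (suc j)) λ j →
                    cong (λ a → replicate a _) (sym (entries-toℕ A i j)))
                 (rowWord-upTo (entries A) (toℕ i) n))
        (word-upTo (entries A) n n)

psiCell : (ℕ → ℕ → ℕ) → ℕ → ℕ → List (ℕ × ℕ)
psiCell f j i = if i ≤ᵇ j then replicate (f i j) (suc j , suc i) else []

psiCells-below : ∀ f → Symmetricℕ f → ∀ j m → m ≤ j →
  concatMap (psiCell f j) (upTo m) ≡ map (suc j ,_) (rowWord f j m)
psiCells-below f f-sym j zero    _   = refl
psiCells-below f f-sym j (suc m) m<j = begin
  concatMap (psiCell f j) (upTo (suc m))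
    ≡⟨ concatMap-upTo-suc (psiCell f j) m ⟩
  concatMap (psiCell f j) (upTo m) ++ psiCell f j m
    ≡⟨ cong₂ _++_ (psiCells-below f f-sym j m (<⇒≤ m<j)) cell ⟩
  map (suc j ,_) (rowWord f j m) ++ map (suc j ,_) (replicate (f j m) (suc m))
    ≡⟨ map-++ (suc j ,_) (rowWord f j m) _ ⟨
  map (suc j ,_) (rowWord f j (suc m)) ∎
  where
  open ≡-Reasoning
  cell : psiCell f j m ≡ map (suc j ,_) (replicate (f j m) (suc m))
  cell rewrite ≤⇒≤ᵇ≡true (<⇒≤ m<j) | f-sym m j = sym (map-replicate (suc j ,_) (f j m) (suc m))

psiCells-column : ∀ f → Symmetricℕ f → ∀ j m → j < m →
  concatMap (psiCell f j) (upTo m) ≡ psiColumn f j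
psiCells-column f f-sym j (suc m) (s≤s j≤m) with m≤n⇒m<n∨m≡n j≤m
... | inj₂ refl rewrite concatMap-upTo-suc (psiCell f j) j | ≤⇒≤ᵇ≡true (≤-refl {j}) =
  cong (_++ replicate (f j j) (suc j , suc j)) (psiCells-below f f-sym j j ≤-refl)
... | inj₁ j<m rewrite concatMap-upTo-suc (psiCell f j) m | >⇒≤ᵇ≡false j<m =
  trans (++-identityʳ _) (psiCells-column f f-sym j m j<m)

psiArray≡psiColumns : ∀ {n} (A : Matrix n) → Symmetric A → psiArray A ≡ psiColumns (entries A) n
psiArray≡psiColumns {n} A A-sym =
  trans (concatMap-allFin n _ column λ j → concatMap-allFin n _ (psiCell (entries A) (toℕ j)) λ i →
           cong (λ a → if _ then replicate a _ else []) (sym (entries-toℕ A i j)))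
        (columns n ≤-refl)
  where
  column : ℕ → List (ℕ × ℕ)
  column j = concatMap (psiCell (entries A) j) (upTo n)
  columns : ∀ m → m ≤ n → concatMap column (upTo m) ≡ psiColumns (entries A) m
  columns zero    _   = refl
  columns (suc m) m<n = trans (concatMap-upTo-suc _ m)
    (cong₂ _++_ (columns m (<⇒≤ m<n)) (psiCells-column (entries A) (entries-symmetric A A-sym) m n m<n))

propositionA1 : ∀ (n : ℕ) (A : Matrix n) → Symmetric A → Ψ A ≡ Φ A
propositionA1 n A A-sym = begin
  Ψ A                                         ≡⟨ cong (foldl psiStep []) (psiArray≡psiColumns A A-sym) ⟩
  foldl psiStep [] (psiColumns (entries A) n) ≡⟨ psiColumns-P (entries A) (entries-symmetric A A-sym) n ⟩
  P (entries A) n n                           ≡⟨ cong (λ w → insertAll w []) (phiWord≡word A) ⟨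
  Φ A                                         ∎
  where open ≡-Reasoning
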